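{- For $n\ge1$, $$s_{\rho_{n-1}}(t_1,\dots,t_n\,|\,t_1,-z_1,t_2,-z_2,\dots,t_{n-1},-z_{n-1})=\prod_{1\le i<j\le n}(t_j+z_i),$$ where $\rho_{n-1}=(n-1,n-2,\dots,1,0)$ is regarded as a partition with $n$ parts.
   Context: $t_i,z_i$ are indeterminates. For a parameter sequence $a=(a_1,a_2,\dots)$ put $(y|a)^k=\prod_{i=1}^k(y-a_i)$. For a partition $\lambda=(\lambda_1\ge\dots\ge\lambda_n\ge0)$ the factorial Schur polynomial is $s_\lambda(x_1,\dots,x_n|a)=\det\big((x_j|a)^{\lambda_i+n-i}\big)_{1\le i,j\le n}/\prod_{1\le i<j\le n}(x_i-x_j)$; it only involves $a_1,\dots,a_{\lambda_1+n-1}$. In the claim, $x_j=t_j$ and $a=(t_1,-z_1,t_2,-z_2,\dots,t_{n-1},-z_{n-1})$. -}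

module Defs where

open import Level using (Level)
open import Data.Nat using (ℕ; zero; suc; _∸_; _<?_) renaming (_+_ to _+ℕ_)
open import Data.Fin using (Fin; toℕ; punchIn) renaming (zero to fzero; suc to fsuc)
open import Relation.Nullary using (yes; no)
open import Algebra.Bundles using (CommutativeRing)

module FactorialSchur {c ℓ : Level} (R : CommutativeRing c ℓ) where
  open CommutativeRing R

  sumFin : (n : ℕ) → (Fin n → Carrier) → Carrier
  sumFin zero    f = 0#
  sumFin (suc n) f = f fzero + sumFin n (λ i → f (fsuc i))

  prodFin : (n : ℕ) → (Fin n → Carrier) → Carrier
  prodFin zero    f = 1#
  prodFin (suc n) f = f fzero * prodFin n (λ i → f (fsuc i))

  prodPairs : (n : ℕ) → (Fin n → Fin n → Carrier) → Carrier
  prodPairs n f = prodFin n (λ i → prodFin n (λ j → pick i j))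
    where
    pick : Fin n → Fin n → Carrier
    pick i j with toℕ i <? toℕ j
    ... | yes _ = f i j
    ... | no  _ = 1#

  sign : ℕ → Carrier
  sign zero    = 1#
  sign (suc k) = - sign k

  det : (n : ℕ) → (Fin n → Fin n → Carrier) → Carrier
  det zero    M = 1#
  det (suc n) M =
    sumFin (suc n) (λ j → sign (toℕ j) * (M fzero j *
      det n (λ r k → M (fsuc r) (punchIn j k))))

  -- factorial power (y|a)^k = ∏_{i=1}^k (y - a_i); the sequence a is 0-based: a 0 = a_1
  fpow : Carrier → (ℕ → Carrier) → ℕ → Carrier
  fpow y a zero    = 1#
  fpow y a (suc k) = fpow y a k * (y - a k)

  -- numerator of the factorial Schur polynomial:
  -- det((x_j|a)^{λ_i+n-i})  (row index i 0-based, so exponent λ_i + (n-1-i))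
  facSchurNum : (n : ℕ) → (Fin n → ℕ) → (Fin n → Carrier) → (ℕ → Carrier) → Carrier
  facSchurNum n lam x a = det n (λ i j → fpow (x j) a (lam i +ℕ (n ∸ 1 ∸ toℕ i)))

  vandermonde : (n : ℕ) → (Fin n → Carrier) → Carrier
  vandermonde n x = prodPairs n (λ i j → x i - x j)

  rho : (n : ℕ) → Fin n → ℕ
  rho n i = n ∸ 1 ∸ toℕ i

  -- parameter sequence (t_1, -z_1, t_2, -z_2, ...), 0-based; t 0 = t_1, z 0 = z_1
  tzSeq : (ℕ → Carrier) → (ℕ → Carrier) → ℕ → Carrier
  tzSeq t z zero          = t 0
  tzSeq t z (suc zero)    = - z 0
  tzSeq t z (suc (suc m)) = tzSeq (λ k → t (suc k)) (λ k → z (suc k)) m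

-- The expansion along the first row has a single term: every entry of that row is the
-- factorial power (t_j | a)^{2(n-1)} = ∏_{m<n-1} (t_j - t_m)(t_j + z_m), which has
-- the root t_j for j < n-1. Only the last column survives, leaving
-- ± ∏_{m<n-1} (t_{n-1} - t_m)(t_{n-1} + z_m) times the same determinant of size n-1;
-- these factors are exactly the pairs (m, n-1) of the two products on the right.
module Submission where

open import Defs
open import Level using (Level)
open import Data.Nat using (ℕ; _≤_)
open import Data.Fin using (Fin; toℕ)
open import Algebra.Bundles using (CommutativeRing)

open import Data.Nat using (zero; suc; _<_; _<?_; z≤n; s≤s; s≤s⁻¹) renaming (_+_ to _+ℕ_)
open import Data.Nat.Properties using (+-suc; ∸-+-assoc; ≤-refl; m<n⇒m<1+n; m≤n⇒m<n∨m≡n; ≤⇒≯)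
open import Data.Fin using (fromℕ; inject₁; punchIn) renaming (zero to fzero; suc to fsuc)
open import Data.Fin.Properties using (toℕ-fromℕ; toℕ-inject₁)
open import Data.Sum using (inj₁; inj₂)
open import Relation.Nullary using (yes; no; ¬_)
open import Relation.Nullary.Negation using (contradiction)
open import Relation.Binary.PropositionalEquality as ≡ using (_≡_)

punchIn-fromℕ : ∀ n (k : Fin n) → punchIn (fromℕ n) k ≡ inject₁ k
punchIn-fromℕ (suc n) fzero    = ≡.refl
punchIn-fromℕ (suc n) (fsuc k) = ≡.cong fsuc (punchIn-fromℕ n k)

module _ {c ℓ : Level} (R : CommutativeRing c ℓ) where
  open CommutativeRing R hiding (zero)
  open FactorialSchur R
  open import Algebra.Properties.Ring ring using (-‿distribˡ-*; -‿distribʳ-*; -‿involutive; ⁻¹-anti-homo‿-)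
  open import Algebra.Solver.CommutativeMonoid *-commutativeMonoid using (solve; _⊕_; _⊜_)
  open import Relation.Binary.Reasoning.Setoid setoid

  ∏< : ℕ → (ℕ → Carrier) → Carrier
  ∏< zero    f = 1#
  ∏< (suc n) f = ∏< n f * f n

  syntax ∏< n (λ m → e) = ∏[ m < n ] e

  ∏-cong : ∀ n {f g : ℕ → Carrier} → (∀ m → m < n → f m ≈ g m) → ∏< n f ≈ ∏< n g
  ∏-cong zero    f≈g = refl
  ∏-cong (suc n) f≈g = *-cong (∏-cong n λ m m<n → f≈g m (m<n⇒m<1+n m<n)) (f≈g n ≤-refl)

  ∏-one : ∀ n {f : ℕ → Carrier} → (∀ m → m < n → f m ≈ 1#) → ∏< n f ≈ 1#
  ∏-one zero    f≈1 = refl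
  ∏-one (suc n) f≈1 =
    trans (*-cong (∏-one n λ m m<n → f≈1 m (m<n⇒m<1+n m<n)) (f≈1 n ≤-refl)) (*-identityʳ 1#)

  ∏-zero : ∀ n (f : ℕ → Carrier) m → m < n → f m ≈ 0# → ∏< n f ≈ 0#
  ∏-zero (suc n) f m (s≤s m≤n) fm≈0 with m≤n⇒m<n∨m≡n m≤n
  ... | inj₁ m<n    = trans (*-cong (∏-zero n f m m<n fm≈0) refl) (zeroˡ _)
  ... | inj₂ ≡.refl = trans (*-cong refl fm≈0) (zeroʳ _)

  ∏-distrib-* : ∀ n (f g : ℕ → Carrier) → ∏[ m < n ] (f m * g m) ≈ ∏< n f * ∏< n g
  ∏-distrib-* zero    f g = sym (*-identityʳ 1#)
  ∏-distrib-* (suc n) f g = trans (*-cong (∏-distrib-* n f g) refl)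
    (solve 4 (λ a b x y → (a ⊕ b) ⊕ (x ⊕ y) ⊜ (a ⊕ x) ⊕ (b ⊕ y)) refl _ _ _ _)

  ∏-neg : ∀ n (f : ℕ → Carrier) → ∏[ m < n ] (- f m) ≈ sign n * ∏< n f
  ∏-neg zero    f = sym (*-identityʳ 1#)
  ∏-neg (suc n) f = begin
    ∏[ m < n ] (- f m) * - f n  ≈⟨ *-cong (∏-neg n f) refl ⟩
    sign n * ∏< n f * - f n     ≈⟨ -‿distribʳ-* _ _ ⟨
    - (sign n * ∏< n f * f n)   ≈⟨ -‿cong (*-assoc _ _ _) ⟩
    - (sign n * ∏< (suc n) f)   ≈⟨ -‿distribˡ-* _ _ ⟩
    sign (suc n) * ∏< (suc n) f ∎

  ∏-first : ∀ n (f : ℕ → Carrier) → ∏< (suc n) f ≈ f 0 * ∏[ m < n ] f (suc m)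
  ∏-first zero    f = *-comm 1# (f 0)
  ∏-first (suc n) f = trans (*-cong (∏-first n f) refl) (*-assoc _ _ _)

  prodFin-cong : ∀ n {f g : Fin n → Carrier} → (∀ i → f i ≈ g i) → prodFin n f ≈ prodFin n g
  prodFin-cong zero    f≈g = refl
  prodFin-cong (suc n) f≈g = *-cong (f≈g fzero) (prodFin-cong n (λ i → f≈g (fsuc i)))

  prodFin≈∏ : ∀ n (f : ℕ → Carrier) → prodFin n (λ i → f (toℕ i)) ≈ ∏< n f
  prodFin≈∏ zero    f = refl
  prodFin≈∏ (suc n) f = trans (*-cong refl (prodFin≈∏ n (λ m → f (suc m)))) (sym (∏-first n f))

  whenLess : (ℕ → ℕ → Carrier) → ℕ → ℕ → Carrier
  whenLess h a b with a <? b
  ... | yes _ = h a b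
  ... | no  _ = 1#

  whenLess-< : ∀ h {a b} → a < b → whenLess h a b ≈ h a b
  whenLess-< h {a} {b} a<b with a <? b
  ... | yes _   = refl
  ... | no  a≮b = contradiction a<b a≮b

  whenLess-≮ : ∀ h {a b} → ¬ a < b → whenLess h a b ≈ 1#
  whenLess-≮ h {a} {b} a≮b with a <? b
  ... | yes a<b = contradiction a<b a≮b
  ... | no  _   = refl

  pairProduct : (ℕ → ℕ → Carrier) → ℕ → Carrier
  pairProduct h n = ∏[ a < n ] ∏[ b < n ] whenLess h a b

  pairProduct-suc : ∀ h n → pairProduct h (suc n) ≈ pairProduct h n * ∏[ a < n ] h a n
  pairProduct-suc h n = begin
    ∏[ a < n ] ∏[ b < suc n ] whenLess h a b * ∏[ b < suc n ] whenLess h n b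
      ≈⟨ *-cong (∏-distrib-* n _ _) (∏-one (suc n) λ b b≤n → whenLess-≮ h (≤⇒≯ (s≤s⁻¹ b≤n))) ⟩
    (pairProduct h n * ∏[ a < n ] whenLess h a n) * 1#
      ≈⟨ *-identityʳ _ ⟩
    pairProduct h n * ∏[ a < n ] whenLess h a n
      ≈⟨ *-cong refl (∏-cong n λ a a<n → whenLess-< h a<n) ⟩
    pairProduct h n * ∏[ a < n ] h a n ∎

  -- The `_` is an entry of prodPairs, computed by a where-bound function of Defs
  -- that cannot be named; its use in prodPairs≈pairProduct solves it.
  mutual
    prodPairs≈pairProduct : ∀ n h → prodPairs n (λ i j → h (toℕ i) (toℕ j)) ≈ pairProduct h n
    prodPairs≈pairProduct n h = begin
      prodPairs n (λ i j → h (toℕ i) (toℕ j))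
        ≈⟨ prodFin-cong n (λ i → prodFin-cong n (prodPairs-entry n h i)) ⟩
      prodFin n (λ i → prodFin n (λ j → whenLess h (toℕ i) (toℕ j)))
        ≈⟨ prodFin-cong n (λ i → prodFin≈∏ n (whenLess h (toℕ i))) ⟩
      prodFin n (λ i → ∏< n (whenLess h (toℕ i)))
        ≈⟨ prodFin≈∏ n (λ a → ∏< n (whenLess h a)) ⟩
      pairProduct h n ∎

    prodPairs-entry : ∀ n h (i j : Fin n) → _ ≈ whenLess h (toℕ i) (toℕ j)
    prodPairs-entry n h i j with toℕ i <? toℕ j
    ... | yes _ = refl
    ... | no  _ = refl

  sumFin-cong : ∀ n {f g : Fin n → Carrier} → (∀ i → f i ≈ g i) → sumFin n f ≈ sumFin n g
  sumFin-cong zero    f≈g = refl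
  sumFin-cong (suc n) f≈g = +-cong (f≈g fzero) (sumFin-cong n (λ i → f≈g (fsuc i)))

  sumFin-last : ∀ n (f : Fin (suc n) → Carrier) → (∀ j → toℕ j < n → f j ≈ 0#) →
    sumFin (suc n) f ≈ f (fromℕ n)
  sumFin-last zero    f f≈0 = +-identityʳ _
  sumFin-last (suc n) f f≈0 = trans
    (+-cong (f≈0 fzero (s≤s z≤n)) (sumFin-last n (λ j → f (fsuc j)) (λ j j<n → f≈0 (fsuc j) (s≤s j<n))))
    (+-identityˡ _)

  minor : ∀ {n} → Fin (suc n) → (Fin (suc n) → Fin (suc n) → Carrier) → Fin n → Fin n → Carrier
  minor j M r k = M (fsuc r) (punchIn j k)

  laplaceTerm : ∀ n → (Fin (suc n) → Fin (suc n) → Carrier) → Fin (suc n) → Carrier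
  laplaceTerm n M j = sign (toℕ j) * (M fzero j * det n (minor j M))

  det-cong : ∀ n {M N : Fin n → Fin n → Carrier} → (∀ i j → M i j ≈ N i j) → det n M ≈ det n N
  det-cong zero    M≈N = refl
  det-cong (suc n) {M} {N} M≈N = sumFin-cong (suc n) {laplaceTerm n M} {laplaceTerm n N} λ j →
    *-cong refl (*-cong (M≈N fzero j) (det-cong n {minor j M} {minor j N} λ r k → M≈N (fsuc r) (punchIn j k)))

  det-firstRow-last : ∀ n (M : Fin (suc n) → Fin (suc n) → Carrier) →
    (∀ j → toℕ j < n → M fzero j ≈ 0#) →
    det (suc n) M ≈ sign n * (M fzero (fromℕ n) * det n (λ r k → M (fsuc r) (inject₁ k)))
  det-firstRow-last n M row≈0 = begin
    det (suc n) M
      ≈⟨ sumFin-last n (laplaceTerm n M) (λ j j<n →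
           trans (*-cong refl (trans (*-cong (row≈0 j j<n) refl) (zeroˡ _))) (zeroʳ _)) ⟩
    sign (toℕ (fromℕ n)) * (M fzero (fromℕ n) * det n (minor (fromℕ n) M))
      ≈⟨ *-cong (reflexive (≡.cong sign (toℕ-fromℕ n)))
           (*-cong refl (det-cong n λ r k → reflexive (≡.cong (M (fsuc r)) (punchIn-fromℕ n k)))) ⟩
    sign n * (M fzero (fromℕ n) * det n (λ r k → M (fsuc r) (inject₁ k))) ∎

  tzSeq-even : ∀ t z m → tzSeq t z (m +ℕ m) ≡ t m
  tzSeq-even t z zero    = ≡.refl
  tzSeq-even t z (suc m) rewrite +-suc m m = tzSeq-even (λ k → t (suc k)) (λ k → z (suc k)) m

  tzSeq-odd : ∀ t z m → tzSeq t z (suc (m +ℕ m)) ≡ - z m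
  tzSeq-odd t z zero    = ≡.refl
  tzSeq-odd t z (suc m) rewrite +-suc m m = tzSeq-odd (λ k → t (suc k)) (λ k → z (suc k)) m

  fpow-tzSeq : ∀ t z y k → fpow y (tzSeq t z) (k +ℕ k) ≈ ∏[ m < k ] ((y - t m) * (y + z m))
  fpow-tzSeq t z y zero    = refl
  fpow-tzSeq t z y (suc k) rewrite +-suc k k | tzSeq-even t z k | tzSeq-odd t z k =
    trans (*-assoc _ _ _) (*-cong (fpow-tzSeq t z y k) (*-cong refl (+-cong refl (-‿involutive (z k)))))

  fpow-tzSeq-root : ∀ t z {j k} → j < k → fpow (t j) (tzSeq t z) (k +ℕ k) ≈ 0#
  fpow-tzSeq-root t z {j} {k} j<k = trans (fpow-tzSeq t z (t j) k)
    (∏-zero k _ j j<k (trans (*-cong (-‿inverseʳ (t j)) refl) (zeroˡ _)))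

  -- facSchurNum n (rho n) is definitionally the determinant of this matrix.
  staircaseMatrix : (t z : ℕ → Carrier) → (n : ℕ) → Fin n → Fin n → Carrier
  staircaseMatrix t z n i j = fpow (t (toℕ j)) (tzSeq t z) (rho n i +ℕ rho n i)

  det-staircaseMatrix-suc : ∀ t z n → det (suc n) (staircaseMatrix t z (suc n))
    ≈ sign n * (fpow (t n) (tzSeq t z) (n +ℕ n) * det n (staircaseMatrix t z n))
  det-staircaseMatrix-suc t z n = trans
    (det-firstRow-last n (staircaseMatrix t z (suc n)) (λ j → fpow-tzSeq-root t z))
    (*-cong refl (*-cong (reflexive (≡.cong (λ m → fpow (t m) (tzSeq t z) (n +ℕ n)) (toℕ-fromℕ n)))
      (det-cong n λ r k → reflexive (≡.cong₂ (λ m e → fpow (t m) (tzSeq t z) (e +ℕ e))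
        (toℕ-inject₁ k) (≡.sym (∸-+-assoc n 1 (toℕ r)))))))

  det-staircaseMatrix : ∀ t z n →
    det n (staircaseMatrix t z n) ≈ pairProduct (λ a b → t a - t b) n * pairProduct (λ a b → t b + z a) n
  det-staircaseMatrix t z zero    = sym (*-identityʳ 1#)
  det-staircaseMatrix t z (suc n) = begin
    det (suc n) (staircaseMatrix t z (suc n))
      ≈⟨ det-staircaseMatrix-suc t z n ⟩
    sign n * (fpow (t n) (tzSeq t z) (n +ℕ n) * det n (staircaseMatrix t z n))
      ≈⟨ *-cong refl (*-cong (trans (fpow-tzSeq t z (t n) n) (∏-distrib-* n _ _)) (det-staircaseMatrix t z n)) ⟩
    sign n * ((∏[ m < n ] (t n - t m) * ∏[ m < n ] (t n + z m)) * (V n * Q n))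
      ≈⟨ solve 5 (λ s p q v w → s ⊕ ((p ⊕ q) ⊕ (v ⊕ w)) ⊜ (v ⊕ (s ⊕ p)) ⊕ (w ⊕ q)) refl _ _ _ _ _ ⟩
    (V n * (sign n * ∏[ m < n ] (t n - t m))) * (Q n * ∏[ m < n ] (t n + z m))
      ≈⟨ *-cong (*-cong refl (sym (∏-neg n _))) refl ⟩
    (V n * ∏[ m < n ] (- (t n - t m))) * (Q n * ∏[ m < n ] (t n + z m))
      ≈⟨ *-cong (*-cong refl (∏-cong n λ m _ → ⁻¹-anti-homo‿- (t n) (t m))) refl ⟩
    (V n * ∏[ m < n ] (t m - t n)) * (Q n * ∏[ m < n ] (t n + z m))
      ≈⟨ *-cong (pairProduct-suc _ n) (pairProduct-suc _ n) ⟨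
    V (suc n) * Q (suc n) ∎
    where
    V Q : ℕ → Carrier
    V = pairProduct (λ a b → t a - t b)
    Q = pairProduct (λ a b → t b + z a)

lemma4p8 : {c ℓ : Level} (R : CommutativeRing c ℓ) →
    let open CommutativeRing R
        open FactorialSchur R
    in (n : ℕ) → 1 ≤ n → (t z : ℕ → Carrier) →
       facSchurNum n (rho n) (λ j → t (toℕ j)) (tzSeq t z)
         ≈ vandermonde n (λ j → t (toℕ j))
           * prodPairs n (λ i j → t (toℕ j) + z (toℕ i))
lemma4p8 R n _ t z = trans (det-staircaseMatrix R t z n)
  (sym (*-cong (prodPairs≈pairProduct R n _) (prodPairs≈pairProduct R n _)))
  where open CommutativeRing R
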